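{- Let $p$ be a positive integer. In the ring $\mathbb{Z}\langle\langle X,Y\rangle\rangle$ of formal power series in non-commuting variables $X,Y$, \[ \sum_{\lambda\in vhC_{(p)}}M(\lambda)=\frac{1}{1-\sum_{1\le a,b<p}Y^aX^b}, \] where $\frac{1}{1-f}=\sum_{k\ge0}f^k$ for $f$ without constant term.
   Context: A partition $\lambda=(\lambda_1,\dots,\lambda_\ell)$ is a finite weakly decreasing sequence of positive integers (the empty partition included), with Young diagram $Y(\lambda)=\{(i,j):1\le i\le\ell,\ 1\le j\le\lambda_i\}$. The $(i,j)$-hook length $h_{i,j}(\lambda)$ is the number of cells $(a,b)\in Y(\lambda)$ with ($a=i$, $b\ge j$) or ($a\ge i$, $b=j$). The $(i,j)$-hook is called vertical if $(i,j+1)\notin Y(\lambda)$ and horizontal if $(i+1,j)\notin Y(\lambda)$. $vhC_{(p)}$ is the set of partitions having no vertical hook of length $p$ and no horizontal hook of length $p$. The partition sequence of $\lambda$ is the word $M(\lambda)=Y^{\lambda_\ell}XY^{\lambda_{\ell-1}-\lambda_\ell}X\cdots Y^{\lambda_1-\lambda_2}X$ in the letters $X,Y$ (equivalently: the word of length $h_{1,1}(\lambda)+1$ whose $t$-th letter is $X$ iff $t=h_{k,1}(\lambda)+1$ for some $k$); $M(())$ is the empty word $1$. Words are identified with monomials. -}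

module Defs where

open import Data.Bool using (Bool; true; false; _∧_; _∨_; not; if_then_else_)
open import Data.Nat as ℕ using (ℕ; zero; suc; _∸_; _≤ᵇ_; _≡ᵇ_)
open import Data.Integer as ℤ using (ℤ; +_)
open import Data.List using (List; []; _∷_; _++_; length; map; concatMap; filterᵇ; foldr; replicate; upTo; applyUpTo; allFin)
import Data.List.Properties as LP
open import Data.Product using (_×_; _,_)
open import Relation.Nullary using (Dec; yes; no; does)
open import Relation.Binary.PropositionalEquality using (_≡_; refl)
open import Relation.Unary using (Decidable)

data Letter : Set where
  X Y : Letter

_≟L_ : (a b : Letter) → Dec (a ≡ b)
X ≟L X = yes refl
X ≟L Y = no (λ ())
Y ≟L X = no (λ ())
Y ≟L Y = yes refl

Word : Set
Word = List Letter

_≟W_ : (u v : Word) → Dec (u ≡ v)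
_≟W_ = LP.≡-dec _≟L_

-- Formal power series Z<<X,Y>> : coefficient functions on words

Series : Set
Series = Word → ℤ

sumℤ : List ℤ → ℤ
sumℤ = foldr ℤ._+_ (+ 0)

mono : Word → Series
mono u w = if does (u ≟W w) then + 1 else + 0

oneS : Series
oneS = mono []

splits : Word → List (Word × Word)
splits [] = ([] , []) ∷ []
splits (x ∷ w) = ([] , x ∷ w) ∷ map (λ { (u , v) → (x ∷ u , v) }) (splits w)

_*S_ : Series → Series → Series
(F *S G) w = sumℤ (map (λ { (u , v) → F u ℤ.* G v }) (splits w))

_^S_ : Series → ℕ → Series
F ^S zero = oneS
F ^S suc k = F *S (F ^S k)

-- 1/(1-F) = Σ_{k≥0} F^k, for F without constant term.  In that case the
-- coefficient of w in F^k vanishes for k > length w, so the coefficient of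
-- w in the infinite sum is the finite sum over k = 0 .. length w.
geomS : Series → Series
geomS F w = sumℤ (map (λ k → (F ^S k) w) (upTo (suc (length w))))

YX : ℕ → ℕ → Word
YX a b = replicate a Y ++ replicate b X

fSeries : ℕ → Series
fSeries p w =
  sumℤ (concatMap (λ a → map (λ b → mono (YX a b) w) (applyUpTo suc (p ∸ 1)))
                  (applyUpTo suc (p ∸ 1)))

rhs : ℕ → Series
rhs p = geomS (fSeries p)

-- Partitions: a partition λ = (λ₁,…,λ_ℓ) is the list λ₁ ∷ … ∷ λ_ℓ ∷ [],
-- weakly decreasing with positive entries.

Partition : Set
Partition = List ℕ

-- λ_i, 1-indexed; 0 when i = 0 or i > ℓ
part : Partition → ℕ → ℕ
part _ zero = 0
part [] (suc i) = 0
part (x ∷ xs) (suc zero) = x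
part (x ∷ xs) (suc (suc i)) = part xs (suc i)

allB : {A : Set} → (A → Bool) → List A → Bool
allB f [] = true
allB f (x ∷ xs) = f x ∧ allB f xs

inY : Partition → ℕ → ℕ → Bool
inY λ' i j = (1 ≤ᵇ i) ∧ (1 ≤ᵇ j) ∧ (j ≤ᵇ part λ' i)

cells : Partition → List (ℕ × ℕ)
cells λ' = concatMap (λ i → map (λ j → (i , j)) (applyUpTo suc (part λ' i)))
                     (applyUpTo suc (length λ'))

hook : Partition → ℕ → ℕ → ℕ
hook λ' i j = length (filterᵇ cond (cells λ'))
  where
  cond : ℕ × ℕ → Bool
  cond (a , b) = ((a ≡ᵇ i) ∧ (j ≤ᵇ b)) ∨ ((i ≤ᵇ a) ∧ (b ≡ᵇ j))

vertical : Partition → ℕ → ℕ → Bool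
vertical λ' i j = not (inY λ' i (suc j))

horizontal : Partition → ℕ → ℕ → Bool
horizontal λ' i j = not (inY λ' (suc i) j)

inVhC : ℕ → Partition → Bool
inVhC p λ' = allB
  (λ { (i , j) → not ((vertical λ' i j ∨ horizontal λ' i j) ∧ (hook λ' i j ≡ᵇ p)) })
  (cells λ')

-- partition sequence M(λ) = Y^{λ_ℓ} X Y^{λ_{ℓ-1}-λ_ℓ} X ⋯ Y^{λ_1-λ_2} X
headOr0 : List ℕ → ℕ
headOr0 [] = 0
headOr0 (x ∷ _) = x

M : Partition → Word
M [] = []
M (x ∷ xs) = M xs ++ (replicate (x ∸ headOr0 xs) Y ++ X ∷ [])

-- all partitions with at most k parts, each part ≤ m (each listed once)
boxParts : ℕ → ℕ → List Partition
boxParts m zero = [] ∷ []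
boxParts m (suc k) = [] ∷ concatMap (λ a → map (a ∷_) (boxParts a k)) (applyUpTo suc m)

-- LHS: Σ_{λ ∈ vhC_(p)} M(λ).  Its coefficient at w is the number of
-- λ ∈ vhC_(p) with M(λ) = w.  Such λ satisfy ℓ + λ₁ = length w, so they
-- all occur in boxParts (length w) (length w).
lhs : ℕ → Series
lhs p w = + length (filterᵇ (λ λ' → inVhC p λ' ∧ does (M λ' ≟W w))
                            (boxParts (length w) (length w)))

{-# OPTIONS --safe #-}

-- Both coefficients of a word w are 0 or 1: each is the indicator that w lies in
-- the language {Y^a X^b : 1 ≤ a, b < p}*, recognised by a deterministic automaton
-- that also counts the blocks Y^a X^b it has read.
--
-- Right-hand side: a word has at most one factorisation into blocks Y⁺X⁺, so the
-- coefficient of w in f_p^k is 1 exactly when the automaton accepts w with k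
-- blocks; summing over k gives acceptance.
--
-- Left-hand side: M is injective on partitions (a left fold decodes it) and its
-- image consists of [] and the words Y u X.  Reading the rows from the shortest,
-- the Y-runs of M(λ) are the differences λᵢ - λᵢ₊₁, and the cells of row i that
-- stick out beyond row i+1 carry horizontal hooks of lengths 1, …, λᵢ - λᵢ₊₁;
-- the X-runs count rows of equal length, and the last cells of such a group of
-- rows carry vertical hooks of lengths 1, …, (size of the group).  Hence
-- λ ∈ vhC_(p) iff every run of M(λ) is shorter than p, i.e. iff M(λ) is accepted.

module Submission where

open import Defs
open import Data.Bool using (Bool; true; false; _∧_; _∨_; not; if_then_else_)
open import Data.Bool.Properties using (∧-assoc; ∧-zeroʳ; ∧-identityʳ; ∨-zeroʳ; T-≡)
open import Data.Empty using (⊥-elim)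
open import Data.Integer as ℤ using (ℤ)
import Data.Integer.Properties as ℤ
open import Data.List
  using (List; []; _∷_; initLast; _∷ʳ′_; _++_; _∷ʳ_; length; map; concatMap; filterᵇ; foldl; replicate; applyUpTo; upTo)
import Data.List.Properties as List
open import Data.List.Relation.Unary.All as All using (All; []; _∷_)
import Data.List.Relation.Unary.All.Properties as AllP
open import Data.Nat
  using (ℕ; zero; suc; _+_; _*_; _∸_; _<_; _≤_; _≤ᵇ_; _<ᵇ_; _≡ᵇ_; z≤n; s≤s; s≤s⁻¹; z<s; s<s; _≟_; _<?_; _≤?_)
open import Data.Nat.ListAction using (sum)
open import Data.Nat.ListAction.Properties using (sum-++)
open import Data.Nat.Properties
open import Data.Nat.Solver using (module +-*-Solver)
open import Data.Product using (_×_; _,_; proj₁; proj₂; map₁; ∃-syntax)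
open import Data.Sum using (inj₁; inj₂)
open import Data.Unit using (⊤; tt)
open import Function using (_∘_; id; Equivalence; mk⇔)
open import Relation.Nullary using (Dec; yes; no; does)
open import Relation.Nullary.Decidable using (dec-true; dec-false; does-⇔)
open import Relation.Binary.PropositionalEquality
  using (_≡_; _≢_; refl; sym; trans; cong; cong₂; subst; ≢-sym; module ≡-Reasoning)

𝟙 : Bool → ℕ
𝟙 true = 1
𝟙 false = 0

𝟙-∧ : ∀ a b → 𝟙 (a ∧ b) ≡ 𝟙 a * 𝟙 b
𝟙-∧ true b = sym (+-identityʳ (𝟙 b))
𝟙-∧ false b = refl

false≢true : false ≢ true
false≢true ()

true⇔true⇒≡ : ∀ {a b : Bool} → (a ≡ true → b ≡ true) → (b ≡ true → a ≡ true) → a ≡ b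
true⇔true⇒≡ {false} {false} _ _ = refl
true⇔true⇒≡ {false} {true} _ b⇒a = b⇒a refl
true⇔true⇒≡ {true} {false} a⇒b _ = sym (a⇒b refl)
true⇔true⇒≡ {true} {true} _ _ = refl

∧-true⁻¹ : ∀ {a b} → a ∧ b ≡ true → a ≡ true × b ≡ true
∧-true⁻¹ {true} b≡true = refl , b≡true

<ᵇ-true⇒< : ∀ {m n} → (m <ᵇ n) ≡ true → m < n
<ᵇ-true⇒< {m} {n} e = <ᵇ⇒< m n (Equivalence.from T-≡ e)

<⇒<ᵇ-true : ∀ {m n} → m < n → (m <ᵇ n) ≡ true
<⇒<ᵇ-true {m} {n} = dec-true (m <? n)

≤ᵇ-∨-≡ᵇ : ∀ j b → (j ≤ᵇ b) ∨ (b ≡ᵇ j) ≡ (j ≤ᵇ b)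
≤ᵇ-∨-≡ᵇ zero b = refl
≤ᵇ-∨-≡ᵇ (suc j) zero = refl
≤ᵇ-∨-≡ᵇ (suc zero) (suc b) = refl
≤ᵇ-∨-≡ᵇ (suc (suc j)) (suc b) = ≤ᵇ-∨-≡ᵇ (suc j) b

not-suc≡ᵇ-∧-<ᵇ : ∀ t p → not (suc t ≡ᵇ p) ∧ (t <ᵇ p) ≡ (suc t <ᵇ p)
not-suc≡ᵇ-∧-<ᵇ zero zero = refl
not-suc≡ᵇ-∧-<ᵇ zero (suc zero) = refl
not-suc≡ᵇ-∧-<ᵇ zero (suc (suc p)) = refl
not-suc≡ᵇ-∧-<ᵇ (suc t) zero = refl
not-suc≡ᵇ-∧-<ᵇ (suc t) (suc p) = not-suc≡ᵇ-∧-<ᵇ t p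

suc<⇒<∸1 : ∀ {i p} → suc i < p → i < p ∸ 1
suc<⇒<∸1 {p = suc p} (s<s i<p) = i<p

<∸1⇒suc< : ∀ {i p} → i < p ∸ 1 → suc i < p
<∸1⇒suc< {p = suc p} i<p = s<s i<p

sum-concatMap : ∀ {A : Set} (f : A → List ℕ) xs → sum (concatMap f xs) ≡ sum (map (sum ∘ f) xs)
sum-concatMap f [] = refl
sum-concatMap f (x ∷ xs) = trans (sum-++ (f x) (concatMap f xs)) (cong (sum (f x) +_) (sum-concatMap f xs))

sum-map-++ : ∀ {A : Set} (g : A → ℕ) xs ys → sum (map g (xs ++ ys)) ≡ sum (map g xs) + sum (map g ys)
sum-map-++ g xs ys = trans (cong sum (List.map-++ g xs ys)) (sum-++ (map g xs) (map g ys))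

sum-map-zero : ∀ {A : Set} (g : A → ℕ) → (∀ x → g x ≡ 0) → ∀ xs → sum (map g xs) ≡ 0
sum-map-zero g g≡0 [] = refl
sum-map-zero g g≡0 (x ∷ xs) = cong₂ _+_ (g≡0 x) (sum-map-zero g g≡0 xs)

length-filterᵇ : ∀ {A : Set} (P : A → Bool) xs → length (filterᵇ P xs) ≡ sum (map (𝟙 ∘ P) xs)
length-filterᵇ P [] = refl
length-filterᵇ P (x ∷ xs) with P x
... | true = cong suc (length-filterᵇ P xs)
... | false = length-filterᵇ P xs

sum-map-applyUpTo-zero : ∀ {A : Set} (g : A → ℕ) (f : ℕ → A) m →
  (∀ i → i < m → g (f i) ≡ 0) → sum (map g (applyUpTo f m)) ≡ 0
sum-map-applyUpTo-zero g f zero _ = refl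
sum-map-applyUpTo-zero g f (suc m) z =
  cong₂ _+_ (z 0 z<s) (sum-map-applyUpTo-zero g (f ∘ suc) m (λ i i<m → z (suc i) (s<s i<m)))

sum-map-applyUpTo-single : ∀ {A : Set} (g : A → ℕ) (f : ℕ → A) {m} x → x < m →
  (∀ i → i < m → i ≢ x → g (f i) ≡ 0) → sum (map g (applyUpTo f m)) ≡ g (f x)
sum-map-applyUpTo-single g f {suc m} zero _ z =
  trans (cong (g (f 0) +_) (sum-map-applyUpTo-zero g (f ∘ suc) m (λ i i<m → z (suc i) (s<s i<m) λ ())))
        (+-identityʳ (g (f 0)))
sum-map-applyUpTo-single g f {suc m} (suc x) (s<s x<m) z =
  cong₂ _+_ (z 0 z<s λ ())
        (sum-map-applyUpTo-single g (f ∘ suc) x x<m (λ i i<m i≢x → z (suc i) (s<s i<m) (i≢x ∘ suc-injective)))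

sum-𝟙-∧-≡ᵇ : ∀ b {c m} → c < m → sum (map (λ n → 𝟙 (b ∧ (c ≡ᵇ n))) (upTo m)) ≡ 𝟙 b
sum-𝟙-∧-≡ᵇ b {c} {m} c<m = begin
  sum (map (λ n → 𝟙 (b ∧ (c ≡ᵇ n))) (upTo m))
    ≡⟨ sum-map-applyUpTo-single _ id c c<m
         (λ i _ i≢c → cong 𝟙 (trans (cong (b ∧_) (dec-false (c ≟ i) (≢-sym i≢c))) (∧-zeroʳ b))) ⟩
  𝟙 (b ∧ (c ≡ᵇ c))
    ≡⟨ cong (𝟙 ∘ (b ∧_)) (dec-true (c ≟ c) refl) ⟩
  𝟙 (b ∧ true)
    ≡⟨ cong 𝟙 (∧-identityʳ b) ⟩
  𝟙 b ∎
  where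
  open ≡-Reasoning

sumℤ-++ : ∀ xs ys → sumℤ (xs ++ ys) ≡ sumℤ xs ℤ.+ sumℤ ys
sumℤ-++ [] ys = sym (ℤ.+-identityˡ (sumℤ ys))
sumℤ-++ (x ∷ xs) ys = trans (cong (ℤ._+_ x) (sumℤ-++ xs ys)) (sym (ℤ.+-assoc x (sumℤ xs) (sumℤ ys)))

sumℤ-concatMap : ∀ {A : Set} (f : A → List ℤ) xs → sumℤ (concatMap f xs) ≡ sumℤ (map (sumℤ ∘ f) xs)
sumℤ-concatMap f [] = refl
sumℤ-concatMap f (x ∷ xs) = trans (sumℤ-++ (f x) (concatMap f xs)) (cong (ℤ._+_ (sumℤ (f x))) (sumℤ-concatMap f xs))

sumℤ-map-+ : ∀ {A : Set} {F : A → ℤ} (g : A → ℕ) → (∀ x → F x ≡ ℤ.+ g x) →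
  ∀ xs → sumℤ (map F xs) ≡ ℤ.+ sum (map g xs)
sumℤ-map-+ g F≡g [] = refl
sumℤ-map-+ g F≡g (x ∷ xs) =
  trans (cong₂ ℤ._+_ (F≡g x) (sumℤ-map-+ g F≡g xs)) (sym (ℤ.pos-+ (g x) (sum (map g xs))))

allB-++ : ∀ {A : Set} (g : A → Bool) xs ys → allB g (xs ++ ys) ≡ allB g xs ∧ allB g ys
allB-++ g [] ys = refl
allB-++ g (x ∷ xs) ys = trans (cong (g x ∧_) (allB-++ g xs ys)) (sym (∧-assoc (g x) (allB g xs) (allB g ys)))

allB-map : ∀ {A B : Set} (g : B → Bool) (f : A → B) xs → allB g (map f xs) ≡ allB (g ∘ f) xs
allB-map g f [] = refl
allB-map g f (x ∷ xs) = cong (g (f x) ∧_) (allB-map g f xs)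

allB-cong : ∀ {A : Set} {f g : A → Bool} → (∀ x → f x ≡ g x) → ∀ xs → allB f xs ≡ allB g xs
allB-cong f≡g [] = refl
allB-cong f≡g (x ∷ xs) = cong₂ _∧_ (f≡g x) (allB-cong f≡g xs)

allB-applyUpTo⁻ : ∀ {A : Set} (g : A → Bool) (f : ℕ → A) m →
  allB g (applyUpTo f m) ≡ true → ∀ i → i < m → g (f i) ≡ true
allB-applyUpTo⁻ g f (suc m) all zero _ = proj₁ (∧-true⁻¹ all)
allB-applyUpTo⁻ g f (suc m) all (suc i) (s<s i<m) = allB-applyUpTo⁻ g (f ∘ suc) m (proj₂ (∧-true⁻¹ {g (f 0)} all)) i i<m

allB-applyUpTo⁺ : ∀ {A : Set} (g : A → Bool) (f : ℕ → A) m →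
  (∀ i → i < m → g (f i) ≡ true) → allB g (applyUpTo f m) ≡ true
allB-applyUpTo⁺ g f zero _ = refl
allB-applyUpTo⁺ g f (suc m) each rewrite each 0 z<s = allB-applyUpTo⁺ g (f ∘ suc) m (λ i i<m → each (suc i) (s<s i<m))

-- Partitions and their words

data BoundedPartition : ℕ → Partition → Set where
  [] : ∀ {m} → BoundedPartition m []
  cons : ∀ {m x xs} → 1 ≤ x → x ≤ m → BoundedPartition x xs → BoundedPartition m (x ∷ xs)

headOr0≤ : ∀ {m λ'} → BoundedPartition m λ' → headOr0 λ' ≤ m
headOr0≤ [] = z≤n
headOr0≤ (cons _ x≤m _) = x≤m

BoundedPartition-weaken : ∀ {m m' λ'} → m ≤ m' → BoundedPartition m λ' → BoundedPartition m' λ'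
BoundedPartition-weaken _ [] = []
BoundedPartition-weaken m≤m' (cons 1≤x x≤m bp) = cons 1≤x (≤-trans x≤m m≤m') bp

BoundedPartition-head : ∀ {m λ'} → BoundedPartition m λ' → BoundedPartition (headOr0 λ') λ'
BoundedPartition-head [] = []
BoundedPartition-head (cons 1≤x _ bp) = cons 1≤x ≤-refl bp

columnLength : Partition → ℕ → ℕ
columnLength [] j = 0
columnLength (x ∷ xs) j = 𝟙 (j ≤ᵇ x) + columnLength xs j

columnLength-beyond : ∀ {m xs} j → BoundedPartition m xs → m < j → columnLength xs j ≡ 0
columnLength-beyond j [] _ = refl
columnLength-beyond j (cons {x = x} _ x≤m bp) m<j =
  cong₂ _+_ (cong 𝟙 (dec-false (j ≤? x) (λ j≤x → <⇒≱ m<j (≤-trans j≤x x≤m))))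
            (columnLength-beyond j bp (≤-<-trans x≤m m<j))

replicate-∷ʳ : ∀ {A : Set} (a : A) n → replicate n a ∷ʳ a ≡ replicate (suc n) a
replicate-∷ʳ a zero = refl
replicate-∷ʳ a (suc n) = cong (a ∷_) (replicate-∷ʳ a n)

length-M : ∀ {m} λ' → BoundedPartition m λ' → length (M λ') ≡ length λ' + headOr0 λ'
length-M [] [] = refl
length-M (x ∷ xs) (cons _ _ bp) = begin
  length (M xs ++ replicate (x ∸ h) Y ++ X ∷ [])
    ≡⟨ List.length-++ (M xs) ⟩
  length (M xs) + length (replicate (x ∸ h) Y ++ X ∷ [])
    ≡⟨ cong₂ _+_ (length-M xs bp) (trans (List.length-++ (replicate (x ∸ h) Y)) (cong (_+ 1) (List.length-replicate (x ∸ h)))) ⟩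
  (length xs + h) + ((x ∸ h) + 1)
    ≡⟨ solve 3 (λ l h d → (l :+ h) :+ (d :+ con 1) := con 1 :+ l :+ (d :+ h)) refl (length xs) h (x ∸ h) ⟩
  suc (length xs + ((x ∸ h) + h))
    ≡⟨ cong (λ n → suc (length xs + n)) (m∸n+n≡m (headOr0≤ bp)) ⟩
  length (x ∷ xs) + x ∎
  where
  open ≡-Reasoning
  open +-*-Solver
  h = headOr0 xs

decodeStep : ℕ × Partition → Letter → ℕ × Partition
decodeStep (c , λ') Y = suc c , λ'
decodeStep (c , λ') X = c , c ∷ λ'

decode : ℕ × Partition → Word → ℕ × Partition
decode = foldl decodeStep

decode-replicateY : ∀ c λ' n w → decode (c , λ') (replicate n Y ++ w) ≡ decode (n + c , λ') w
decode-replicateY c λ' zero w = refl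
decode-replicateY c λ' (suc n) w = trans (decode-replicateY (suc c) λ' n w) (cong (λ k → decode (k , λ') w) (+-suc n c))

decode-M : ∀ {m} λ' → BoundedPartition m λ' → decode (0 , []) (M λ') ≡ (headOr0 λ' , λ')
decode-M [] [] = refl
decode-M (x ∷ xs) (cons _ _ bp) = begin
  decode (0 , []) (M xs ++ replicate (x ∸ headOr0 xs) Y ++ X ∷ [])
    ≡⟨ List.foldl-++ decodeStep (0 , []) (M xs) _ ⟩
  decode (decode (0 , []) (M xs)) (replicate (x ∸ headOr0 xs) Y ++ X ∷ [])
    ≡⟨ cong (λ s → decode s (replicate (x ∸ headOr0 xs) Y ++ X ∷ [])) (decode-M xs bp) ⟩
  decode (headOr0 xs , xs) (replicate (x ∸ headOr0 xs) Y ++ X ∷ [])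
    ≡⟨ decode-replicateY (headOr0 xs) xs (x ∸ headOr0 xs) (X ∷ []) ⟩
  ((x ∸ headOr0 xs) + headOr0 xs , (x ∸ headOr0 xs) + headOr0 xs ∷ xs)
    ≡⟨ cong (λ k → (k , k ∷ xs)) (m∸n+n≡m (headOr0≤ bp)) ⟩
  (x , x ∷ xs) ∎
  where open ≡-Reasoning

M-injective : ∀ {m m' λ' μ} → BoundedPartition m λ' → BoundedPartition m' μ → M λ' ≡ M μ → λ' ≡ μ
M-injective {λ' = λ'} {μ} bpλ bpμ Mλ≡Mμ =
  cong proj₂ (trans (sym (decode-M λ' bpλ)) (trans (cong (decode (0 , [])) Mλ≡Mμ) (decode-M μ bpμ)))

-- (c , λ) describes the word read so far: the rows λ, each closed by an X,
-- followed by the Y's of a row of length c under construction.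
Encodes : ℕ × Partition → Word → Set
Encodes (c , λ') u = 1 ≤ c × BoundedPartition c λ' × M λ' ++ replicate (c ∸ headOr0 λ') Y ≡ u

M-close : ∀ {c λ' u} → Encodes (c , λ') u → M (c ∷ λ') ≡ u ∷ʳ X
M-close {λ' = λ'} (_ , _ , enc) = trans (sym (List.++-assoc (M λ') _ _)) (cong (_∷ʳ X) enc)

decodeStep-Encodes : ∀ s u a → Encodes s u → Encodes (decodeStep s a) (u ∷ʳ a)
decodeStep-Encodes (c , λ') u Y (1≤c , bp , enc) =
  m≤n⇒m≤1+n 1≤c , BoundedPartition-weaken (n≤1+n c) bp , (begin
    M λ' ++ replicate (suc c ∸ h) Y        ≡⟨ cong (λ n → M λ' ++ replicate n Y) (+-∸-assoc 1 (headOr0≤ bp)) ⟩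
    M λ' ++ replicate (suc (c ∸ h)) Y      ≡⟨ cong (M λ' ++_) (sym (replicate-∷ʳ Y (c ∸ h))) ⟩
    M λ' ++ (replicate (c ∸ h) Y ∷ʳ Y)     ≡⟨ sym (List.++-assoc (M λ') _ _) ⟩
    (M λ' ++ replicate (c ∸ h) Y) ∷ʳ Y     ≡⟨ cong (_∷ʳ Y) enc ⟩
    u ∷ʳ Y ∎)
  where
  open ≡-Reasoning
  h = headOr0 λ'
decodeStep-Encodes (c , λ') u X enc@(1≤c , bp , _) =
  1≤c , cons 1≤c ≤-refl bp ,
  trans (cong (λ n → M (c ∷ λ') ++ replicate n Y) (n∸n≡0 c)) (trans (List.++-identityʳ (M (c ∷ λ'))) (M-close enc))

decode-Encodes : ∀ s u w → Encodes s u → Encodes (decode s w) (u ++ w)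
decode-Encodes s u [] enc = subst (Encodes s) (sym (List.++-identityʳ u)) enc
decode-Encodes s u (a ∷ w) enc =
  subst (Encodes (decode s (a ∷ w))) (List.++-assoc u (a ∷ []) w)
        (decode-Encodes (decodeStep s a) (u ∷ʳ a) w (decodeStep-Encodes s u a enc))

M-onto : ∀ u → ∃[ λ' ] BoundedPartition (headOr0 λ') λ' × M λ' ≡ Y ∷ u ∷ʳ X
M-onto u with decode (1 , []) u | decode-Encodes (1 , []) (Y ∷ []) u (≤-refl , [] , refl)
... | c , λ' | enc@(1≤c , bp , _) = c ∷ λ' , cons 1≤c ≤-refl bp , M-close enc

boxParts-BoundedPartition : ∀ m k → All (BoundedPartition m) (boxParts m k)
boxParts-BoundedPartition m zero = [] ∷ []
boxParts-BoundedPartition m (suc k) =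
  [] ∷ AllP.concat⁺ (AllP.map⁺ (AllP.applyUpTo⁺₁ suc m (λ {i} i<m →
         AllP.map⁺ (All.map (cons (s≤s z≤n) i<m) (boxParts-BoundedPartition (suc i) k)))))

_≟P_ : (λ' μ : Partition) → Dec (λ' ≡ μ)
_≟P_ = List.≡-dec _≟_

boxParts-occurs-once : ∀ {m} k μ → BoundedPartition m μ → length μ ≤ k →
  sum (map (λ λ' → 𝟙 (does (λ' ≟P μ))) (boxParts m k)) ≡ 1
boxParts-occurs-once zero [] [] _ = refl
boxParts-occurs-once {m} (suc k) [] [] _ =
  cong suc (trans (cong sum (List.map-concatMap _ (λ a → map (a ∷_) (boxParts a k)) (applyUpTo suc m)))
                  (trans (sum-concatMap _ (applyUpTo suc m))
                         (sum-map-zero _ (λ a → trans (cong sum (sym (List.map-∘ (boxParts a k))))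
                                                      (sum-map-zero _ (λ _ → refl) (boxParts a k)))
                                       (applyUpTo suc m))))
boxParts-occurs-once {m} (suc k) (suc x ∷ xs) (cons _ x<m bp) (s≤s |xs|≤k) = begin
  sum (map isμ (concatMap (λ a → map (a ∷_) (boxParts a k)) (applyUpTo suc m)))
    ≡⟨ cong sum (List.map-concatMap isμ (λ a → map (a ∷_) (boxParts a k)) (applyUpTo suc m)) ⟩
  sum (concatMap (λ a → map isμ (map (a ∷_) (boxParts a k))) (applyUpTo suc m))
    ≡⟨ sum-concatMap _ (applyUpTo suc m) ⟩
  sum (map (λ a → sum (map isμ (map (a ∷_) (boxParts a k)))) (applyUpTo suc m))
    ≡⟨ sum-map-applyUpTo-single _ suc x x<m otherHeads ⟩
  sum (map isμ (map (suc x ∷_) (boxParts (suc x) k)))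
    ≡⟨ cong sum (trans (sym (List.map-∘ (boxParts (suc x) k))) (List.map-cong sameHead (boxParts (suc x) k))) ⟩
  sum (map (λ λ' → 𝟙 (does (λ' ≟P xs))) (boxParts (suc x) k))
    ≡⟨ boxParts-occurs-once k xs bp |xs|≤k ⟩
  1 ∎
  where
  open ≡-Reasoning
  isμ = λ λ' → 𝟙 (does (λ' ≟P (suc x ∷ xs)))
  sameHead : ∀ λ' → isμ (suc x ∷ λ') ≡ 𝟙 (does (λ' ≟P xs))
  sameHead λ' = cong 𝟙 (does-⇔ (mk⇔ List.∷-injectiveʳ (cong (suc x ∷_))) ((suc x ∷ λ') ≟P (suc x ∷ xs)) (λ' ≟P xs))
  otherHeads : ∀ i → i < m → i ≢ x → sum (map isμ (map (suc i ∷_) (boxParts (suc i) k))) ≡ 0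
  otherHeads i _ i≢x =
    trans (cong sum (sym (List.map-∘ (boxParts (suc i) k))))
          (sum-map-zero _ (λ λ' → cong 𝟙 (dec-false ((suc i ∷ λ') ≟P (suc x ∷ xs))
                                                    (i≢x ∘ suc-injective ∘ List.∷-injectiveˡ)))
                        (boxParts (suc i) k))

-- Hook lengths in the first row

-- Y(λ) with 0-based row indices.  Passing through map (map₁ suc) keeps row
-- indices of the form suc i, on which the ≡ᵇ/≤ᵇ tests of hook lengths compute.
cells₀ : Partition → List (ℕ × ℕ)
cells₀ λ' = concatMap (λ i → map (i ,_) (applyUpTo suc (part λ' (suc i)))) (upTo (length λ'))

concatMap-applyUpTo-suc : ∀ {A : Set} (f : ℕ → List A) n → concatMap f (applyUpTo suc n) ≡ concatMap (f ∘ suc) (upTo n)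
concatMap-applyUpTo-suc f n = trans (cong (concatMap f) (sym (List.map-upTo suc n))) (List.concatMap-map f suc (upTo n))

cells≡cells₀ : ∀ λ' → cells λ' ≡ map (map₁ suc) (cells₀ λ')
cells≡cells₀ λ' =
  trans (concatMap-applyUpTo-suc _ (length λ'))
        (trans (List.concatMap-cong (λ i → List.map-∘ (applyUpTo suc (part λ' (suc i)))) (upTo (length λ')))
               (sym (List.map-concatMap (map₁ suc) _ (upTo (length λ')))))

cells₀-∷ : ∀ x xs → cells₀ (x ∷ xs) ≡ map (0 ,_) (applyUpTo suc x) ++ map (map₁ suc) (cells₀ xs)
cells₀-∷ x xs = cong (map (0 ,_) (applyUpTo suc x) ++_)
  (trans (concatMap-applyUpTo-suc _ (length xs))
         (trans (List.concatMap-cong (λ i → List.map-∘ (applyUpTo suc (part xs (suc i)))) (upTo (length xs)))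
                (sym (List.map-concatMap (map₁ suc) _ (upTo (length xs))))))

inHook : ℕ → ℕ → ℕ × ℕ → Bool
inHook i j (a , b) = ((a ≡ᵇ i) ∧ (j ≤ᵇ b)) ∨ ((i ≤ᵇ a) ∧ (b ≡ᵇ j))

hook-cells₀ : ∀ λ' i j → hook λ' i j ≡ sum (map (𝟙 ∘ inHook i j ∘ map₁ suc) (cells₀ λ'))
hook-cells₀ λ' i j =
  trans (length-filterᵇ (inHook i j) (cells λ'))
        (cong sum (trans (cong (map (𝟙 ∘ inHook i j)) (cells≡cells₀ λ')) (sym (List.map-∘ (cells₀ λ')))))

hook-∷ : ∀ x xs i j → hook (x ∷ xs) i j ≡
  sum (map (λ b → 𝟙 (inHook i j (1 , b))) (applyUpTo suc x))
    + sum (map (𝟙 ∘ inHook i j ∘ map₁ suc ∘ map₁ suc) (cells₀ xs))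
hook-∷ x xs i j = begin
  hook (x ∷ xs) i j
    ≡⟨ hook-cells₀ (x ∷ xs) i j ⟩
  sum (map g (cells₀ (x ∷ xs)))
    ≡⟨ cong (sum ∘ map g) (cells₀-∷ x xs) ⟩
  sum (map g (map (0 ,_) (applyUpTo suc x) ++ map (map₁ suc) (cells₀ xs)))
    ≡⟨ sum-map-++ g (map (0 ,_) (applyUpTo suc x)) (map (map₁ suc) (cells₀ xs)) ⟩
  sum (map g (map (0 ,_) (applyUpTo suc x))) + sum (map g (map (map₁ suc) (cells₀ xs)))
    ≡⟨ cong₂ _+_ (cong sum (sym (List.map-∘ (applyUpTo suc x)))) (cong sum (sym (List.map-∘ (cells₀ xs)))) ⟩
  sum (map (λ b → 𝟙 (inHook i j (1 , b))) (applyUpTo suc x)) + sum (map (g ∘ map₁ suc) (cells₀ xs)) ∎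
  where
  open ≡-Reasoning
  g = 𝟙 ∘ inHook i j ∘ map₁ suc

hook-∷-lower : ∀ x xs i j → hook (x ∷ xs) (suc (suc i)) j ≡ hook xs (suc i) j
hook-∷-lower x xs i j =
  trans (hook-∷ x xs (suc (suc i)) j)
        (trans (cong (_+ _) (sum-map-zero _ (λ _ → refl) (applyUpTo suc x))) (sym (hook-cells₀ xs (suc i) j)))

count-≤ᵇ : ∀ j x → 1 ≤ j → sum (map (λ b → 𝟙 (j ≤ᵇ b)) (applyUpTo suc x)) ≡ suc x ∸ j
count-≤ᵇ (suc j) zero _ = sym (0∸n≡0 j)
count-≤ᵇ j (suc x) 1≤j = begin
  sum (map g (applyUpTo suc (suc x)))
    ≡⟨ cong (sum ∘ map g) (sym (List.applyUpTo-∷ʳ suc x)) ⟩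
  sum (map g (applyUpTo suc x ∷ʳ suc x))
    ≡⟨ sum-map-++ g (applyUpTo suc x) (suc x ∷ []) ⟩
  sum (map g (applyUpTo suc x)) + (g (suc x) + 0)
    ≡⟨ cong₂ _+_ (count-≤ᵇ j x 1≤j) (+-identityʳ (g (suc x))) ⟩
  (suc x ∸ j) + 𝟙 (j ≤ᵇ suc x)
    ≡⟨ lastTerm (j ≤? suc x) ⟩
  suc (suc x) ∸ j ∎
  where
  open ≡-Reasoning
  g = λ b → 𝟙 (j ≤ᵇ b)
  lastTerm : Dec (j ≤ suc x) → (suc x ∸ j) + 𝟙 (j ≤ᵇ suc x) ≡ suc (suc x) ∸ j
  lastTerm (yes j≤) rewrite dec-true (j ≤? suc x) j≤ = trans (+-comm (suc x ∸ j) 1) (sym (+-∸-assoc 1 j≤))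
  lastTerm (no j≰) rewrite dec-false (j ≤? suc x) j≰ =
    trans (+-identityʳ _) (trans (m≤n⇒m∸n≡0 (≤-trans (n≤1+n (suc x)) (≰⇒> j≰))) (sym (m≤n⇒m∸n≡0 (≰⇒> j≰))))

count-≡ᵇ : ∀ j y → 1 ≤ j → sum (map (λ b → 𝟙 (b ≡ᵇ j)) (applyUpTo suc y)) ≡ 𝟙 (j ≤ᵇ y)
count-≡ᵇ (suc j) y _ with suc j ≤? y
... | yes j<y = trans (sum-map-applyUpTo-single _ suc j j<y (λ i _ i≢j → cong 𝟙 (dec-false (i ≟ j) i≢j)))
                      (trans (cong 𝟙 (dec-true (j ≟ j) refl)) (sym (cong 𝟙 (dec-true (suc j ≤? y) j<y))))
... | no j≮y = trans (sum-map-applyUpTo-zero _ suc y (λ i i<y → cong 𝟙 (dec-false (i ≟ j) (λ { refl → j≮y i<y }))))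
                     (sym (cong 𝟙 (dec-false (suc j ≤? y) j≮y)))

count-column : ∀ j xs → 1 ≤ j → sum (map (λ c → 𝟙 (proj₂ c ≡ᵇ j)) (cells₀ xs)) ≡ columnLength xs j
count-column j [] _ = refl
count-column j (y ∷ ys) 1≤j = begin
  sum (map g (cells₀ (y ∷ ys)))
    ≡⟨ cong (sum ∘ map g) (cells₀-∷ y ys) ⟩
  sum (map g (map (0 ,_) (applyUpTo suc y) ++ map (map₁ suc) (cells₀ ys)))
    ≡⟨ sum-map-++ g (map (0 ,_) (applyUpTo suc y)) (map (map₁ suc) (cells₀ ys)) ⟩
  sum (map g (map (0 ,_) (applyUpTo suc y))) + sum (map g (map (map₁ suc) (cells₀ ys)))
    ≡⟨ cong₂ _+_ (trans (cong sum (sym (List.map-∘ (applyUpTo suc y)))) (count-≡ᵇ j y 1≤j))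
                 (trans (cong sum (sym (List.map-∘ (cells₀ ys)))) (count-column j ys 1≤j)) ⟩
  𝟙 (j ≤ᵇ y) + columnLength ys j ∎
  where
  open ≡-Reasoning
  g = λ c → 𝟙 (proj₂ c ≡ᵇ j)

hook-∷-first : ∀ x xs j → 1 ≤ j → hook (x ∷ xs) 1 j ≡ (suc x ∸ j) + columnLength xs j
hook-∷-first x xs j 1≤j =
  trans (hook-∷ x xs 1 j)
        (cong₂ _+_ (trans (cong sum (List.map-cong (λ b → cong 𝟙 (≤ᵇ-∨-≡ᵇ j b)) (applyUpTo suc x)))
                          (count-≤ᵇ j x 1≤j))
                   (count-column j xs 1≤j))

-- Partitions without vertical or horizontal hooks of length p

hookFree : ℕ → Partition → ℕ × ℕ → Bool
hookFree p λ' (i , j) = not ((vertical λ' i j ∨ horizontal λ' i j) ∧ (hook λ' i j ≡ᵇ p))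

inVhC-∷ : ∀ p x xs → inVhC p (x ∷ xs) ≡ allB (λ j → hookFree p (x ∷ xs) (1 , j)) (applyUpTo suc x) ∧ inVhC p xs
inVhC-∷ p x xs = begin
  allB g (cells (x ∷ xs))
    ≡⟨ trans (cong (allB g) (cells≡cells₀ (x ∷ xs))) (allB-map g (map₁ suc) (cells₀ (x ∷ xs))) ⟩
  allB (g ∘ map₁ suc) (cells₀ (x ∷ xs))
    ≡⟨ trans (cong (allB (g ∘ map₁ suc)) (cells₀-∷ x xs))
             (allB-++ (g ∘ map₁ suc) (map (0 ,_) (applyUpTo suc x)) (map (map₁ suc) (cells₀ xs))) ⟩
  allB (g ∘ map₁ suc) (map (0 ,_) (applyUpTo suc x)) ∧ allB (g ∘ map₁ suc) (map (map₁ suc) (cells₀ xs))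
    ≡⟨ cong₂ _∧_ (allB-map (g ∘ map₁ suc) (0 ,_) (applyUpTo suc x)) (allB-map (g ∘ map₁ suc) (map₁ suc) (cells₀ xs)) ⟩
  allB (λ j → g (1 , j)) (applyUpTo suc x) ∧ allB (g ∘ map₁ suc ∘ map₁ suc) (cells₀ xs)
    ≡⟨ cong (allB (λ j → g (1 , j)) (applyUpTo suc x) ∧_) (allB-cong lowerRows (cells₀ xs)) ⟩
  allB (λ j → g (1 , j)) (applyUpTo suc x) ∧ allB (hookFree p xs ∘ map₁ suc) (cells₀ xs)
    ≡⟨ cong (allB (λ j → g (1 , j)) (applyUpTo suc x) ∧_)
            (trans (sym (allB-map (hookFree p xs) (map₁ suc) (cells₀ xs)))
                   (cong (allB (hookFree p xs)) (sym (cells≡cells₀ xs)))) ⟩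
  allB (λ j → g (1 , j)) (applyUpTo suc x) ∧ inVhC p xs ∎
  where
  open ≡-Reasoning
  g = hookFree p (x ∷ xs)
  lowerRows : ∀ c → g (map₁ suc (map₁ suc c)) ≡ hookFree p xs (map₁ suc c)
  lowerRows (a , b) = cong (λ h → not ((vertical xs (suc a) b ∨ horizontal xs (suc a) b) ∧ (h ≡ᵇ p))) (hook-∷-lower x xs a b)

part-1 : ∀ xs → part xs 1 ≡ headOr0 xs
part-1 [] = refl
part-1 (_ ∷ _) = refl

firstRow-hookFree-cell : ∀ p x xs i → hookFree p (x ∷ xs) (1 , suc i) ≡
  not ((not (suc i <ᵇ x) ∨ not (i <ᵇ headOr0 xs)) ∧ ((x ∸ i) + columnLength xs (suc i) ≡ᵇ p))
firstRow-hookFree-cell p x xs i rewrite hook-∷-first x xs (suc i) (s≤s z≤n) | part-1 xs = refl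

firstRow-hookFree-corner : ∀ p x xs → hookFree p (suc x ∷ xs) (1 , suc x) ≡ not (suc (columnLength xs (suc x)) ≡ᵇ p)
firstRow-hookFree-corner p x xs
  rewrite firstRow-hookFree-cell p (suc x) xs x | dec-false (x <? x) (<-irrefl refl) | m+n∸n≡m 1 x = refl

firstRow-hookFree-inner : ∀ p x xs i → suc i < x → i < headOr0 xs → hookFree p (x ∷ xs) (1 , suc i) ≡ true
firstRow-hookFree-inner p x xs i i+1<x i<h
  rewrite firstRow-hookFree-cell p x xs i | <⇒<ᵇ-true i+1<x | <⇒<ᵇ-true i<h = refl

firstRow-hookFree-overhang : ∀ {m} p x xs i → BoundedPartition m xs → headOr0 xs ≤ i →
  hookFree p (x ∷ xs) (1 , suc i) ≡ not (x ∸ i ≡ᵇ p)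
firstRow-hookFree-overhang p x xs i bp h≤i
  rewrite firstRow-hookFree-cell p x xs i | dec-false (i <? headOr0 xs) (≤⇒≯ h≤i)
        | columnLength-beyond (suc i) (BoundedPartition-head bp) (s≤s h≤i) | +-identityʳ (x ∸ i)
        | ∨-zeroʳ (not (suc i <ᵇ x)) = refl

-- The first row has a horizontal hook of every length 1, …, λ₁ - λ₂ and a
-- single vertical hook, at its last cell.
firstRowFree : ℕ → ℕ → Partition → Bool
firstRowFree p x xs = (x ∸ headOr0 xs <ᵇ p) ∧ not (suc (columnLength xs x) ≡ᵇ p)

firstRowFree⇒hookFree : ∀ {m} p x xs → BoundedPartition m xs → firstRowFree p x xs ≡ true →
  ∀ i → i < x → hookFree p (x ∷ xs) (1 , suc i) ≡ true
firstRowFree⇒hookFree p (suc x) xs bp free i i<1+x with m≤n⇒m<n∨m≡n (s≤s⁻¹ i<1+x)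
... | inj₂ refl = trans (firstRow-hookFree-corner p x xs) (proj₂ (∧-true⁻¹ free))
... | inj₁ i<x with i <? headOr0 xs
...   | yes i<h = firstRow-hookFree-inner p (suc x) xs i (s≤s i<x) i<h
...   | no i≮h = trans (firstRow-hookFree-overhang p (suc x) xs i bp h≤i) (cong not (dec-false (suc x ∸ i ≟ p) x∸i≢p))
  where
  h≤i : headOr0 xs ≤ i
  h≤i = ≮⇒≥ i≮h
  x∸i≢p : suc x ∸ i ≢ p
  x∸i≢p x∸i≡p = <-irrefl x∸i≡p (≤-<-trans (∸-monoʳ-≤ (suc x) h≤i) (<ᵇ-true⇒< (proj₁ (∧-true⁻¹ free))))

hookFree⇒firstRowFree : ∀ p x xs → 1 ≤ p → BoundedPartition (suc x) xs →
  (∀ i → i < suc x → hookFree p (suc x ∷ xs) (1 , suc i) ≡ true) → firstRowFree p (suc x) xs ≡ true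
hookFree⇒firstRowFree p x xs 1≤p bp free = cong₂ _∧_ overhang<p (trans (sym (firstRow-hookFree-corner p x xs)) (free x ≤-refl))
  where
  h = headOr0 xs
  overhang<p : (suc x ∸ h <ᵇ p) ≡ true
  overhang<p with suc x ∸ h <? p
  ... | yes x∸h<p = <⇒<ᵇ-true x∸h<p
  ... | no x∸h≮p = ⊥-elim (false≢true (trans (sym hookLength≡p) (free (suc x ∸ p) (∸-monoʳ-< 1≤p p≤x))))
    where
    p≤x∸h : p ≤ suc x ∸ h
    p≤x∸h = ≮⇒≥ x∸h≮p
    p≤x : p ≤ suc x
    p≤x = ≤-trans p≤x∸h (m∸n≤m (suc x) h)
    h≤x∸p : h ≤ suc x ∸ p
    h≤x∸p = m+n≤o⇒m≤o∸n h (≤-trans (+-monoʳ-≤ h p≤x∸h) (≤-reflexive (m+[n∸m]≡n (headOr0≤ bp))))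
    -- The cell (1, λ₁ - p + 1) sticks out beyond the second row: its hook is
    -- horizontal, of length p.
    hookLength≡p : hookFree p (suc x ∷ xs) (1 , suc (suc x ∸ p)) ≡ false
    hookLength≡p = begin
      hookFree p (suc x ∷ xs) (1 , suc (suc x ∸ p)) ≡⟨ firstRow-hookFree-overhang p (suc x) xs (suc x ∸ p) bp h≤x∸p ⟩
      not (suc x ∸ (suc x ∸ p) ≡ᵇ p)               ≡⟨ cong (λ n → not (n ≡ᵇ p)) (m∸[m∸n]≡n p≤x) ⟩
      not (p ≡ᵇ p)                                 ≡⟨ cong not (dec-true (p ≟ p) refl) ⟩
      false ∎
      where open ≡-Reasoning

firstRow-hookFree : ∀ {m} p x xs → 1 ≤ p → BoundedPartition m (x ∷ xs) →
  allB (λ j → hookFree p (x ∷ xs) (1 , j)) (applyUpTo suc x) ≡ firstRowFree p x xs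
firstRow-hookFree p (suc x) xs 1≤p (cons _ _ bp) =
  true⇔true⇒≡ (hookFree⇒firstRowFree p x xs 1≤p bp ∘ allB-applyUpTo⁻ firstRow suc (suc x))
              (allB-applyUpTo⁺ firstRow suc (suc x) ∘ firstRowFree⇒hookFree p (suc x) xs bp)
  where
  firstRow = λ j → hookFree p (suc x ∷ xs) (1 , j)

inVhC-∷-firstRowFree : ∀ {m} p x xs → 1 ≤ p → BoundedPartition m (x ∷ xs) →
  inVhC p (x ∷ xs) ≡ firstRowFree p x xs ∧ inVhC p xs
inVhC-∷-firstRowFree p x xs 1≤p bp = trans (inVhC-∷ p x xs) (cong (_∧ inVhC p xs) (firstRow-hookFree p x xs 1≤p bp))

firstRowFree-equal : ∀ p h xs → 1 ≤ p → firstRowFree p h (h ∷ xs) ≡ not (suc (suc (columnLength xs h)) ≡ᵇ p)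
firstRowFree-equal p h xs 1≤p =
  cong₂ _∧_ (trans (cong (_<ᵇ p) (n∸n≡0 h)) (<⇒<ᵇ-true 1≤p))
            (cong (λ b → not (suc (𝟙 b + columnLength xs h) ≡ᵇ p)) (dec-true (h ≤? h) ≤-refl))

firstRowFree-longer : ∀ p x xs → BoundedPartition x xs → headOr0 xs < x →
  firstRowFree p x xs ≡ (x ∸ headOr0 xs <ᵇ p) ∧ not (1 ≡ᵇ p)
firstRowFree-longer p x xs bp h<x =
  cong (λ n → (x ∸ headOr0 xs <ᵇ p) ∧ not (suc n ≡ᵇ p)) (columnLength-beyond x (BoundedPartition-head bp) h<x)

-- An automaton recognising {Y^a X^b : 1 ≤ a, b < p}* and counting blocks

-- In readingY c k and readingX c k the automaton is inside the c-th block and has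
-- read k letters of the current run; a run is compared with p only when it ends.
data State : Set where
  start dead : State
  readingY readingX : (block runLength : ℕ) → State

block : State → ℕ
block (readingY c _) = c
block (readingX c _) = c
block _ = 0

AtLeastBlocks : ℕ → State → Set
AtLeastBlocks n start = n ≡ 0
AtLeastBlocks n dead = ⊤
AtLeastBlocks n (readingY c _) = n ≤ c
AtLeastBlocks n (readingX c _) = n ≤ c

nextBlock : State → State
nextBlock (readingY c k) = readingY (suc c) k
nextBlock (readingX c k) = readingX (suc c) k
nextBlock s = s

module Automaton (p : ℕ) where

  step : State → Letter → State
  step start Y = readingY 1 1
  step start X = dead
  step (readingY c k) Y = readingY c (suc k)
  step (readingY c k) X = if k <ᵇ p then readingX c 1 else dead
  step (readingX c k) X = readingX c (suc k)
  step (readingX c k) Y = if k <ᵇ p then readingY (suc c) 1 else dead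
  step dead _ = dead

  run : State → Word → State
  run = foldl step

  accepts : State → Bool
  accepts start = true
  accepts (readingX _ k) = k <ᵇ p
  accepts _ = false

  acceptsWith : ℕ → State → Bool
  acceptsWith n s = accepts s ∧ (block s ≡ᵇ n)

  run-++ : ∀ s u v → run s (u ++ v) ≡ run (run s u) v
  run-++ = List.foldl-++ step

  run-dead : ∀ w → run dead w ≡ dead
  run-dead [] = refl
  run-dead (_ ∷ w) = run-dead w

  run-replicateY : ∀ c k n w → run (readingY c k) (replicate n Y ++ w) ≡ run (readingY c (n + k)) w
  run-replicateY c k zero w = refl
  run-replicateY c k (suc n) w = trans (run-replicateY c (suc k) n w) (cong (λ j → run (readingY c j) w) (+-suc n k))

  run-replicateX : ∀ c k n → run (readingX c k) (replicate n X) ≡ readingX c (n + k)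
  run-replicateX c k zero = refl
  run-replicateX c k (suc n) = trans (run-replicateX c (suc k) n) (cong (readingX c) (+-suc n k))

  accepts-step-Y : ∀ s → accepts (step s Y) ≡ false
  accepts-step-Y start = refl
  accepts-step-Y dead = refl
  accepts-step-Y (readingY c k) = refl
  accepts-step-Y (readingX c k) with k <ᵇ p
  ... | true = refl
  ... | false = refl

  step-AtLeastBlocks : ∀ {n} s a → AtLeastBlocks n s → AtLeastBlocks n (step s a)
  step-AtLeastBlocks start Y refl = z≤n
  step-AtLeastBlocks start X _ = tt
  step-AtLeastBlocks dead a _ = tt
  step-AtLeastBlocks (readingY c k) Y n≤c = n≤c
  step-AtLeastBlocks (readingY c k) X n≤c with k <ᵇ p
  ... | true = n≤c
  ... | false = tt
  step-AtLeastBlocks (readingX c k) X n≤c = n≤c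
  step-AtLeastBlocks (readingX c k) Y n≤c with k <ᵇ p
  ... | true = m≤n⇒m≤1+n n≤c
  ... | false = tt

  run-AtLeastBlocks : ∀ {n} s w → AtLeastBlocks n s → AtLeastBlocks n (run s w)
  run-AtLeastBlocks s [] h = h
  run-AtLeastBlocks s (a ∷ w) h = run-AtLeastBlocks (step s a) w (step-AtLeastBlocks s a h)

  acceptsWith-AtLeastBlocks : ∀ n s → AtLeastBlocks (suc n) s → acceptsWith n s ≡ false
  acceptsWith-AtLeastBlocks n dead _ = refl
  acceptsWith-AtLeastBlocks n (readingY c k) _ = refl
  acceptsWith-AtLeastBlocks n (readingX c k) n<c =
    trans (cong ((k <ᵇ p) ∧_) (dec-false (c ≟ n) (>⇒≢ n<c))) (∧-zeroʳ (k <ᵇ p))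

  rejects-AtLeastBlocks : ∀ {n} s w → AtLeastBlocks (suc n) s → acceptsWith n (run s w) ≢ true
  rejects-AtLeastBlocks {n} s w h = false≢true ∘ trans (sym (acceptsWith-AtLeastBlocks n _ (run-AtLeastBlocks s w h)))

  step-nextBlock : ∀ s a → AtLeastBlocks 1 s → step (nextBlock s) a ≡ nextBlock (step s a)
  step-nextBlock dead a _ = refl
  step-nextBlock (readingY c k) Y _ = refl
  step-nextBlock (readingY c k) X _ with k <ᵇ p
  ... | true = refl
  ... | false = refl
  step-nextBlock (readingX c k) X _ = refl
  step-nextBlock (readingX c k) Y _ with k <ᵇ p
  ... | true = refl
  ... | false = refl

  run-nextBlock : ∀ s w → AtLeastBlocks 1 s → run (nextBlock s) w ≡ nextBlock (run s w)
  run-nextBlock s [] _ = refl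
  run-nextBlock s (a ∷ w) h =
    trans (cong (λ t → run t w) (step-nextBlock s a h)) (run-nextBlock (step s a) w (step-AtLeastBlocks s a h))

  acceptsWith-nextBlock : ∀ n s → AtLeastBlocks 1 s → acceptsWith (suc n) (nextBlock s) ≡ acceptsWith n s
  acceptsWith-nextBlock n dead _ = refl
  acceptsWith-nextBlock n (readingY c k) _ = refl
  acceptsWith-nextBlock n (readingX c k) _ = refl

  block-step : ∀ s a → block (step s a) ≤ suc (block s)
  block-step start Y = ≤-refl
  block-step start X = z≤n
  block-step dead a = z≤n
  block-step (readingY c k) Y = n≤1+n c
  block-step (readingY c k) X with k <ᵇ p
  ... | true = n≤1+n c
  ... | false = z≤n
  block-step (readingX c k) X = n≤1+n c
  block-step (readingX c k) Y with k <ᵇ p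
  ... | true = ≤-refl
  ... | false = z≤n

  block-run : ∀ s w → block (run s w) ≤ block s + length w
  block-run s [] = ≤-reflexive (sym (+-identityʳ (block s)))
  block-run s (a ∷ w) = begin
    block (run (step s a) w)   ≤⟨ block-run (step s a) w ⟩
    block (step s a) + length w ≤⟨ +-monoˡ-≤ (length w) (block-step s a) ⟩
    suc (block s) + length w   ≡⟨ sym (+-suc (block s) (length w)) ⟩
    block s + length (a ∷ w)   ∎
    where open ≤-Reasoning

-- The right-hand side

mono-𝟙 : ∀ v w → mono v w ≡ ℤ.+ 𝟙 (does (v ≟W w))
mono-𝟙 v w with does (v ≟W w)
... | true = refl
... | false = refl

replicate-injective : ∀ (x : Letter) {m n} → replicate m x ≡ replicate n x → m ≡ n
replicate-injective x {m} {n} e = trans (sym (List.length-replicate m)) (trans (cong length e) (List.length-replicate n))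

YX-injective : ∀ a b a' b' → YX a b ≡ YX a' b' → a ≡ a' × b ≡ b'
YX-injective zero b zero b' e = refl , replicate-injective X e
YX-injective (suc a) b (suc a') b' e with YX-injective a b a' b' (List.∷-injectiveʳ e)
... | refl , refl = refl , refl
YX-injective zero (suc b) (suc a') b' ()
YX-injective zero zero (suc a') b' ()
YX-injective (suc a) b zero (suc b') ()
YX-injective (suc a) b zero zero ()

module _ (p : ℕ) where

  open Automaton p

  acceptsOne-YX : ∀ a b → suc a < p → suc b < p → acceptsWith 1 (run start (YX (suc a) (suc b))) ≡ true
  acceptsOne-YX a b a<p b<p
    rewrite run-replicateY 1 1 a (X ∷ replicate b X) | +-comm a 1 | <⇒<ᵇ-true a<p
          | run-replicateX 1 1 b | +-comm b 1 = trans (∧-identityʳ _) (<⇒<ᵇ-true b<p)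

  readingX-acceptsOne-inversion : ∀ j u → acceptsWith 1 (run (readingX 1 j) u) ≡ true →
    ∃[ m ] u ≡ replicate m X × m + j < p
  readingX-acceptsOne-inversion j [] e = 0 , refl , <ᵇ-true⇒< (trans (sym (∧-identityʳ (j <ᵇ p))) e)
  readingX-acceptsOne-inversion j (X ∷ u) e with readingX-acceptsOne-inversion (suc j) u e
  ... | m , refl , m+1+j<p = suc m , refl , subst (_< p) (+-suc m j) m+1+j<p
  readingX-acceptsOne-inversion j (Y ∷ u) e with j <ᵇ p
  ... | true = ⊥-elim (rejects-AtLeastBlocks (readingY 2 1) u ≤-refl e)
  ... | false = ⊥-elim (rejects-AtLeastBlocks dead u tt e)

  readingY-acceptsOne-inversion : ∀ i u → acceptsWith 1 (run (readingY 1 i) u) ≡ true →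
    ∃[ a ] ∃[ b ] u ≡ replicate a Y ++ replicate (suc b) X × a + i < p × suc b < p
  readingY-acceptsOne-inversion i (Y ∷ u) e with readingY-acceptsOne-inversion (suc i) u e
  ... | a , b , refl , a+1+i<p , b<p = suc a , b , refl , subst (_< p) (+-suc a i) a+1+i<p , b<p
  readingY-acceptsOne-inversion i (X ∷ u) e with i <ᵇ p in i<ᵇp
  ... | true with readingX-acceptsOne-inversion 1 u e
  ...   | m , refl , m+1<p = 0 , m , refl , <ᵇ-true⇒< i<ᵇp , subst (_< p) (+-comm m 1) m+1<p
  readingY-acceptsOne-inversion i (X ∷ u) e | false = ⊥-elim (rejects-AtLeastBlocks dead u tt e)

  acceptsOne-inversion : ∀ u → acceptsWith 1 (run start u) ≡ true →
    ∃[ a ] ∃[ b ] u ≡ YX (suc a) (suc b) × suc a < p × suc b < p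
  acceptsOne-inversion (Y ∷ u) e with readingY-acceptsOne-inversion 1 u e
  ... | a , b , refl , a+1<p , b<p = a , b , refl , subst (_< p) (+-comm a 1) a+1<p , b<p
  acceptsOne-inversion (X ∷ u) e = ⊥-elim (rejects-AtLeastBlocks dead u tt e)

  positivesBelowP : List ℕ
  positivesBelowP = applyUpTo suc (p ∸ 1)

  count-YX : ∀ u → sum (map (λ a → sum (map (λ b → 𝟙 (does (YX a b ≟W u))) positivesBelowP)) positivesBelowP)
                   ≡ 𝟙 (acceptsWith 1 (run start u))
  count-YX u with acceptsWith 1 (run start u) in accepted
  ... | true with acceptsOne-inversion u accepted
  ...   | a , b , refl , a<p , b<p =
    trans (sum-map-applyUpTo-single _ suc a (suc<⇒<∸1 a<p) otherRows)
          (trans (sum-map-applyUpTo-single _ suc b (suc<⇒<∸1 b<p) otherColumns)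
                 (cong 𝟙 (dec-true (YX (suc a) (suc b) ≟W YX (suc a) (suc b)) refl)))
    where
    otherRows : ∀ i → i < p ∸ 1 → i ≢ a →
      sum (map (λ b' → 𝟙 (does (YX (suc i) b' ≟W YX (suc a) (suc b)))) positivesBelowP) ≡ 0
    otherRows i _ i≢a = sum-map-applyUpTo-zero _ suc (p ∸ 1) λ j _ →
      cong 𝟙 (dec-false (YX (suc i) (suc j) ≟W _)
                        (i≢a ∘ suc-injective ∘ proj₁ ∘ YX-injective (suc i) (suc j) (suc a) (suc b)))
    otherColumns : ∀ j → j < p ∸ 1 → j ≢ b → 𝟙 (does (YX (suc a) (suc j) ≟W YX (suc a) (suc b))) ≡ 0
    otherColumns j _ j≢b =
      cong 𝟙 (dec-false (YX (suc a) (suc j) ≟W _)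
                        (j≢b ∘ suc-injective ∘ proj₂ ∘ YX-injective (suc a) (suc j) (suc a) (suc b)))
  count-YX u | false =
    sum-map-applyUpTo-zero _ suc (p ∸ 1) λ i i<p → sum-map-applyUpTo-zero _ suc (p ∸ 1) λ j j<p →
      cong 𝟙 (dec-false (YX (suc i) (suc j) ≟W u) λ YX≡u →
        false≢true (trans (sym accepted) (subst (λ v → acceptsWith 1 (run start v) ≡ true) YX≡u
          (acceptsOne-YX i j (<∸1⇒suc< i<p) (<∸1⇒suc< j<p)))))

  fSeries-𝟙 : ∀ u → fSeries p u ≡ ℤ.+ 𝟙 (acceptsWith 1 (run start u))
  fSeries-𝟙 u = begin
    fSeries p u
      ≡⟨ sumℤ-concatMap (λ a → map (λ b → mono (YX a b) u) positivesBelowP) positivesBelowP ⟩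
    sumℤ (map (λ a → sumℤ (map (λ b → mono (YX a b) u) positivesBelowP)) positivesBelowP)
      ≡⟨ sumℤ-map-+ _ (λ a → sumℤ-map-+ _ (λ b → mono-𝟙 (YX a b) u) positivesBelowP) positivesBelowP ⟩
    ℤ.+ sum (map (λ a → sum (map (λ b → 𝟙 (does (YX a b ≟W u))) positivesBelowP)) positivesBelowP)
      ≡⟨ cong ℤ.+_ (count-YX u) ⟩
    ℤ.+ 𝟙 (acceptsWith 1 (run start u)) ∎
    where open ≡-Reasoning

  splitCount : ℕ → State → Word → ℕ
  splitCount k s w = sum (map (λ uv → 𝟙 (acceptsWith 1 (run s (proj₁ uv)) ∧ acceptsWith k (run start (proj₂ uv)))) (splits w))

  splitCount-∷ : ∀ k s a w →
    splitCount k s (a ∷ w) ≡ 𝟙 (acceptsWith 1 s ∧ acceptsWith k (run start (a ∷ w))) + splitCount k (step s a) w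
  splitCount-∷ k s a w =
    cong (𝟙 (acceptsWith 1 s ∧ acceptsWith k (run start (a ∷ w))) +_)
         (cong sum (trans (sym (List.map-∘ (splits w))) (List.map-cong (λ { (u , v) → refl }) (splits w))))

  splitCount-AtLeastBlocks : ∀ k s w → AtLeastBlocks 2 s → splitCount k s w ≡ 0
  splitCount-AtLeastBlocks k s [] h rewrite acceptsWith-AtLeastBlocks 1 s h = refl
  splitCount-AtLeastBlocks k s (a ∷ w) h rewrite splitCount-∷ k s a w | acceptsWith-AtLeastBlocks 1 s h =
    splitCount-AtLeastBlocks k (step s a) w (step-AtLeastBlocks s a h)

  data AtMostOneBlock : State → Set where
    start : AtMostOneBlock start
    dead : AtMostOneBlock dead
    readingY : ∀ i → AtMostOneBlock (readingY 1 i)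
    readingX : ∀ j → AtMostOneBlock (readingX 1 j)

  -- The only split w = u v counted here cuts w at the end of its first block, and
  -- v is then read from start exactly as w is read from s, with one block fewer.
  splitCount-AtMostOneBlock : ∀ k {s} w → AtMostOneBlock s → splitCount k s w ≡ 𝟙 (acceptsWith (suc k) (run s w))
  splitCount-AtMostOneBlock k [] start = refl
  splitCount-AtMostOneBlock k [] dead = refl
  splitCount-AtMostOneBlock k [] (readingY i) = refl
  splitCount-AtMostOneBlock k [] (readingX j) with j <ᵇ p
  ... | true = +-identityʳ _
  ... | false = refl
  splitCount-AtMostOneBlock k (Y ∷ w) start =
    trans (splitCount-∷ k start Y w) (splitCount-AtMostOneBlock k w (readingY 1))
  splitCount-AtMostOneBlock k (X ∷ w) start =
    trans (splitCount-∷ k start X w) (splitCount-AtMostOneBlock k w dead)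
  splitCount-AtMostOneBlock k (a ∷ w) dead =
    trans (splitCount-∷ k dead a w) (splitCount-AtMostOneBlock k w dead)
  splitCount-AtMostOneBlock k (Y ∷ w) (readingY i) =
    trans (splitCount-∷ k (readingY 1 i) Y w) (splitCount-AtMostOneBlock k w (readingY (suc i)))
  splitCount-AtMostOneBlock k (X ∷ w) (readingY i) rewrite splitCount-∷ k (readingY 1 i) X w with i <ᵇ p
  ... | true = splitCount-AtMostOneBlock k w (readingX 1)
  ... | false = splitCount-AtMostOneBlock k w dead
  splitCount-AtMostOneBlock k (X ∷ w) (readingX j)
    rewrite splitCount-∷ k (readingX 1 j) X w | run-dead w | ∧-zeroʳ ((j <ᵇ p) ∧ true) =
    splitCount-AtMostOneBlock k w (readingX (suc j))
  splitCount-AtMostOneBlock k (Y ∷ w) (readingX j) rewrite splitCount-∷ k (readingX 1 j) Y w with j <ᵇ p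
  ... | false = splitCount-AtMostOneBlock k w dead
  ... | true = begin
    𝟙 (acceptsWith k (run (readingY 1 1) w)) + splitCount k (readingY 2 1) w
      ≡⟨ cong (𝟙 (acceptsWith k (run (readingY 1 1) w)) +_) (splitCount-AtLeastBlocks k (readingY 2 1) w ≤-refl) ⟩
    𝟙 (acceptsWith k (run (readingY 1 1) w)) + 0
      ≡⟨ +-identityʳ _ ⟩
    𝟙 (acceptsWith k (run (readingY 1 1) w))
      ≡⟨ cong 𝟙 (sym (acceptsWith-nextBlock k _ (run-AtLeastBlocks (readingY 1 1) w ≤-refl))) ⟩
    𝟙 (acceptsWith (suc k) (nextBlock (run (readingY 1 1) w)))
      ≡⟨ cong (𝟙 ∘ acceptsWith (suc k)) (sym (run-nextBlock (readingY 1 1) w ≤-refl)) ⟩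
    𝟙 (acceptsWith (suc k) (run (readingY 2 1) w)) ∎
    where open ≡-Reasoning

  power-𝟙 : ∀ k w → (fSeries p ^S k) w ≡ ℤ.+ 𝟙 (acceptsWith k (run start w))
  power-𝟙 zero [] = refl
  power-𝟙 zero (a ∷ w) =
    cong (ℤ.+_ ∘ 𝟙) (sym (acceptsWith-AtLeastBlocks 0 _ (run-AtLeastBlocks (step start a) w (firstLetter a))))
    where
    firstLetter : ∀ a → AtLeastBlocks 1 (step start a)
    firstLetter Y = ≤-refl
    firstLetter X = tt
  power-𝟙 (suc k) w =
    trans (sumℤ-map-+ _ (λ { (u , v) → product-𝟙 u v }) (splits w))
          (cong ℤ.+_ (splitCount-AtMostOneBlock k w start))
    where
    product-𝟙 : ∀ u v → fSeries p u ℤ.* (fSeries p ^S k) v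
                        ≡ ℤ.+ 𝟙 (acceptsWith 1 (run start u) ∧ acceptsWith k (run start v))
    product-𝟙 u v = begin
      fSeries p u ℤ.* (fSeries p ^S k) v
        ≡⟨ cong₂ ℤ._*_ (fSeries-𝟙 u) (power-𝟙 k v) ⟩
      ℤ.+ 𝟙 (acceptsWith 1 (run start u)) ℤ.* ℤ.+ 𝟙 (acceptsWith k (run start v))
        ≡⟨ sym (ℤ.pos-* (𝟙 (acceptsWith 1 (run start u))) (𝟙 (acceptsWith k (run start v)))) ⟩
      ℤ.+ (𝟙 (acceptsWith 1 (run start u)) * 𝟙 (acceptsWith k (run start v)))
        ≡⟨ cong ℤ.+_ (sym (𝟙-∧ (acceptsWith 1 (run start u)) (acceptsWith k (run start v)))) ⟩
      ℤ.+ 𝟙 (acceptsWith 1 (run start u) ∧ acceptsWith k (run start v)) ∎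
      where open ≡-Reasoning

  rhs-𝟙 : ∀ w → rhs p w ≡ ℤ.+ 𝟙 (accepts (run start w))
  rhs-𝟙 w = trans (sumℤ-map-+ _ (λ k → power-𝟙 k w) (upTo (suc (length w))))
                  (cong ℤ.+_ (sum-𝟙-∧-≡ᵇ (accepts (run start w)) (s≤s (block-run start w))))

-- The left-hand side

module _ (p : ℕ) where

  open Automaton p

  -- After reading M λ with λ ≠ [], the final X-run has one letter per row of length λ₁.
  data RowState : Partition → State → Set where
    start : RowState [] start
    dead : ∀ {λ'} → RowState λ' dead
    readingX : ∀ {x xs} c → RowState (x ∷ xs) (readingX c (suc (columnLength xs x)))

  run-row : ∀ c d → run (readingY c 1) (replicate d Y ++ X ∷ []) ≡ (if suc d <ᵇ p then readingX c 1 else dead)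
  run-row c d = trans (run-replicateY c 1 d (X ∷ [])) (cong (λ k → if k <ᵇ p then readingX c 1 else dead) (+-comm d 1))

  run-longerRow : ∀ c t n → 1 ≤ n →
    run (readingX c t) (replicate n Y ++ X ∷ []) ≡ (if (t <ᵇ p) ∧ (n <ᵇ p) then readingX (suc c) 1 else dead)
  run-longerRow c t (suc d) _ with t <ᵇ p
  ... | true = run-row (suc c) d
  ... | false = run-dead (replicate d Y ++ X ∷ [])

  closeLongerRow : ∀ x xs c {s'} → 1 ≤ p → BoundedPartition x xs → headOr0 xs < x → (b : Bool) →
    s' ≡ (if b ∧ (x ∸ headOr0 xs <ᵇ p) then readingX c 1 else dead) →
    (firstRowFree p x xs ∧ b ≡ accepts s') × RowState (x ∷ xs) s'
  closeLongerRow x xs c 1≤p bp h<x b refl rewrite firstRowFree-longer p x xs bp h<x with b | x ∸ headOr0 xs <? p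
  ... | false | _ = ∧-zeroʳ _ , dead
  ... | true | no x∸h≮p rewrite dec-false (x ∸ headOr0 xs <? p) x∸h≮p = refl , dead
  ... | true | yes x∸h<p rewrite dec-true (x ∸ headOr0 xs <? p) x∸h<p =
    trans (∧-identityʳ _) (trans (cong not (dec-false (1 ≟ p) (<⇒≢ 1<p))) (sym (<⇒<ᵇ-true 1<p))) ,
    subst (λ n → RowState (x ∷ xs) (readingX c (suc n))) (columnLength-beyond x (BoundedPartition-head bp) h<x) (readingX c)
    where
    1<p : 1 < p
    1<p = ≤-<-trans (m<n⇒0<n∸m h<x) x∸h<p

  closeRow : ∀ {m} x xs s → 1 ≤ p → BoundedPartition m (x ∷ xs) → RowState xs s →
    (firstRowFree p x xs ∧ accepts s ≡ accepts (run s (replicate (x ∸ headOr0 xs) Y ++ X ∷ [])))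
    × RowState (x ∷ xs) (run s (replicate (x ∸ headOr0 xs) Y ++ X ∷ []))
  closeRow x xs dead 1≤p bp dead rewrite run-dead (replicate (x ∸ headOr0 xs) Y ++ X ∷ []) = ∧-zeroʳ _ , dead
  closeRow (suc d) [] start 1≤p (cons _ _ bp) start = closeLongerRow (suc d) [] 1 1≤p bp z<s true (run-row 1 d)
  closeRow x (h ∷ xs) _ 1≤p (cons _ _ bp) (readingX c) with m≤n⇒m<n∨m≡n (headOr0≤ bp)
  ... | inj₁ h<x = closeLongerRow x (h ∷ xs) (suc c) 1≤p bp h<x (t <ᵇ p) (run-longerRow c t (x ∸ h) (m<n⇒0<n∸m h<x))
    where t = suc (columnLength xs h)
  ... | inj₂ refl =
    trans (cong (_∧ (t <ᵇ p)) (firstRowFree-equal p h xs 1≤p)) (trans (not-suc≡ᵇ-∧-<ᵇ t p) (cong accepts (sym run≡))) ,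
    subst (RowState (h ∷ h ∷ xs)) (sym run≡)
          (subst (λ b → RowState (h ∷ h ∷ xs) (readingX c (suc (𝟙 b + columnLength xs h))))
                 (dec-true (h ≤? h) ≤-refl) (readingX c))
    where
    t = suc (columnLength xs h)
    run≡ : run (readingX c t) (replicate (h ∸ h) Y ++ X ∷ []) ≡ readingX c (suc t)
    run≡ = cong (λ n → run (readingX c t) (replicate n Y ++ X ∷ [])) (n∸n≡0 h)

  inVhC≡accepts-M : ∀ {m} λ' → 1 ≤ p → BoundedPartition m λ' →
    (inVhC p λ' ≡ accepts (run start (M λ'))) × RowState λ' (run start (M λ'))
  inVhC≡accepts-M [] _ [] = refl , start
  inVhC≡accepts-M (x ∷ xs) 1≤p bp@(cons _ _ bp') with inVhC≡accepts-M xs 1≤p bp'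
  ... | free≡accepts , rows with closeRow x xs _ 1≤p bp rows
  ...   | closed≡ , rows' =
    trans (inVhC-∷-firstRowFree p x xs 1≤p bp)
          (trans (cong (firstRowFree p x xs ∧_) free≡accepts) (trans closed≡ (cong accepts (sym run-M)))) ,
    subst (RowState (x ∷ xs)) (sym run-M) rows'
    where
    run-M = run-++ start (M xs) (replicate (x ∸ headOr0 xs) Y ++ X ∷ [])

  accepted⇒image-M : ∀ w → accepts (run start w) ≡ true → ∃[ μ ] BoundedPartition (headOr0 μ) μ × M μ ≡ w
  accepted⇒image-M w acc with initLast w
  ... | [] = [] , [] , refl
  ... | v ∷ʳ′ Y =
    ⊥-elim (false≢true (trans (sym (accepts-step-Y (run start v))) (trans (cong accepts (sym (List.foldl-∷ʳ step start Y v))) acc)))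
  ... | [] ∷ʳ′ X = ⊥-elim (false≢true acc)
  ... | (X ∷ v) ∷ʳ′ X = ⊥-elim (false≢true (trans (sym (cong accepts (run-dead (v ∷ʳ X)))) acc))
  ... | (Y ∷ u) ∷ʳ′ X = M-onto u

  isVhCPreimage : Word → Partition → Bool
  isVhCPreimage w λ' = inVhC p λ' ∧ does (M λ' ≟W w)

  count-rejected : 1 ≤ p → ∀ w → accepts (run start w) ≡ false →
    sum (map (𝟙 ∘ isVhCPreimage w) (boxParts (length w) (length w))) ≡ 0
  count-rejected 1≤p w rejected =
    trans (cong sum (List.map-cong-local (All.map (cong 𝟙 ∘ notPreimage) (boxParts-BoundedPartition n n))))
          (sum-map-zero _ (λ _ → refl) (boxParts n n))
    where
    n = length w
    notPreimage : ∀ {λ'} → BoundedPartition n λ' → inVhC p λ' ∧ does (M λ' ≟W w) ≡ false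
    notPreimage {λ'} bp with M λ' ≟W w
    ... | yes Mλ'≡w =
      trans (∧-identityʳ _) (trans (proj₁ (inVhC≡accepts-M λ' 1≤p bp)) (trans (cong (accepts ∘ run start) Mλ'≡w) rejected))
    ... | no _ = ∧-zeroʳ _

  count-accepted : 1 ≤ p → ∀ w → accepts (run start w) ≡ true →
    sum (map (𝟙 ∘ isVhCPreimage w) (boxParts (length w) (length w))) ≡ 1
  count-accepted 1≤p w accepted with accepted⇒image-M w accepted
  ... | μ , bpμ , Mμ≡w =
    trans (cong sum (List.map-cong-local (All.map (cong 𝟙 ∘ preimage≡μ) (boxParts-BoundedPartition n n))))
          (boxParts-occurs-once n μ (BoundedPartition-weaken (subst (headOr0 μ ≤_) (sym n≡) (m≤n+m _ _)) bpμ)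
                                    (subst (length μ ≤_) (sym n≡) (m≤m+n _ _)))
    where
    n = length w
    n≡ : n ≡ length μ + headOr0 μ
    n≡ = trans (cong length (sym Mμ≡w)) (length-M μ bpμ)
    preimage≡μ : ∀ {λ'} → BoundedPartition n λ' → inVhC p λ' ∧ does (M λ' ≟W w) ≡ does (λ' ≟P μ)
    preimage≡μ {λ'} bp with λ' ≟P μ | M λ' ≟W w
    ... | yes refl | Mμ≟w =
      cong₂ _∧_ (trans (proj₁ (inVhC≡accepts-M μ 1≤p bpμ)) (trans (cong (accepts ∘ run start) Mμ≡w) accepted))
                (dec-true Mμ≟w Mμ≡w)
    ... | no λ'≢μ | yes Mλ'≡w = ⊥-elim (λ'≢μ (M-injective bp bpμ (trans Mλ'≡w (sym Mμ≡w))))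
    ... | no _ | no _ = ∧-zeroʳ _

  lhs-𝟙 : 1 ≤ p → ∀ w → lhs p w ≡ ℤ.+ 𝟙 (accepts (run start w))
  lhs-𝟙 1≤p w =
    cong ℤ.+_ (trans (length-filterᵇ (isVhCPreimage w) (boxParts (length w) (length w))) (count (accepts (run start w)) refl))
    where
    count : ∀ b → accepts (run start w) ≡ b → sum (map (𝟙 ∘ isVhCPreimage w) (boxParts (length w) (length w))) ≡ 𝟙 b
    count false = count-rejected 1≤p w
    count true = count-accepted 1≤p w

mainTheorem6 : (p : ℕ) → 1 ≤ p → (w : Word) → lhs p w ≡ rhs p w
mainTheorem6 p 1≤p w = trans (lhs-𝟙 p 1≤p w) (sym (rhs-𝟙 p w))
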